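{- For all integers $n\ge1$, \[ \sum_{k=1}^{n}\binom{n+1}{k+1}\frac{(-1)^{k+1}}{k+1}H_{k}=\frac{1}{2}\left\{(H_{n+1})^{2}-H_{n+1}^{(2)}\right\}. \]
   Context: $H_n=1+\frac12+\cdots+\frac1n$ and $H_n^{(2)}=1+\frac{1}{2^2}+\cdots+\frac{1}{n^2}$. -}

module Defs where

open import Data.Nat as ℕ using (ℕ; zero; suc)
open import Data.Nat.Combinatorics using (_C_)
open import Data.Integer as ℤ using (+_)
open import Data.Rational using (ℚ; 0ℚ; _+_; _*_; _/_; -_)

sumTo : ℕ → (ℕ → ℚ) → ℚ
sumTo zero    f = 0ℚ
sumTo (suc m) f = sumTo m f + f (suc m)

inv : ℕ → ℚ
inv zero    = 0ℚ
inv (suc j) = + 1 / suc j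

H : ℕ → ℚ
H n = sumTo n inv

H2 : ℕ → ℚ
H2 n = sumTo n (λ k → inv k * inv k)

sgn : ℕ → ℚ
sgn zero    = + 1 / 1
sgn (suc m) = - sgn m

fromℕ : ℕ → ℚ
fromℕ m = + m / 1

-- The proof runs through the binomial transform  T N g = Σ_{j=0}^{N} C(N,j) (-1)^j g j.
-- Pascal's rule gives  T (N+1) g = T N g − T N (g ∘ suc),  and the absorption identity
-- C(N,i)/(i+1) = C(N+1,i+1)/(N+1)  turns  T N (i ↦ f (i+1)/(i+1))  into  −(T (N+1) f − f 0)/(N+1).
-- Starting from  T (N+1) 1 = 0  these two rules compute in turn  T N (i ↦ 1/(i+1)) = 1/(N+1),
-- T N H = −1/N,  T (N+1) (j ↦ H_{j−1}) = H_N  and finally  T m (j ↦ H_{j−1}/j) = e₂(1, 1/2, …, 1/m),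
-- which is the right-hand side; the left-hand side is  T (n+1) (j ↦ H_{j−1}/j)  re-indexed.
module Submission where

open import Defs
open import Data.Nat as ℕ using (ℕ; zero; suc; pred; _≤_)
open import Data.Nat.Combinatorics using (_C_; nCk+nC[k+1]≡[n+1]C[k+1]; nC1≡n; k>n⇒nCk≡0)
import Data.Nat.Properties as ℕ
import Data.Nat.Tactic.RingSolver as ℕ-Solver
open import Data.Integer as ℤ using (+_)
import Data.Integer.Properties as ℤ
open import Data.Rational using (ℚ; mkℚ; 0ℚ; 1ℚ; _+_; _*_; _-_; -_; _/_; fromℚᵘ)
open import Data.Rational.Properties
  using (+-*-commutativeRing; toℚᵘ-injective; toℚᵘ-fromℚᵘ; fromℚᵘ-cong; toℚᵘ-homo-+; toℚᵘ-homo-*;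
         +-assoc; +-identityˡ; +-identityʳ; +-inverseʳ; *-identityˡ; *-identityʳ; *-zeroˡ; *-zeroʳ; *-distribˡ-+)
open import Data.Rational.Unnormalised as ℚᵘ using (mkℚᵘ; *≡*)
import Data.Rational.Unnormalised.Properties as ℚᵘ
open import Data.List using ([]; _∷_)
open import Data.Maybe using (just; nothing)
open import Level using (0ℓ)
open import Tactic.RingSolver using (solve; solve-∀)
open import Tactic.RingSolver.Core.AlmostCommutativeRing using (AlmostCommutativeRing; fromCommutativeRing)
open import Relation.Binary.PropositionalEquality
open ≡-Reasoning

-- Without recognising the zero coefficient the solver cannot normalise.
ℚ-ring : AlmostCommutativeRing 0ℓ 0ℓ
ℚ-ring = fromCommutativeRing +-*-commutativeRing λ { (mkℚ ℤ.+0 zero _) → just refl ; _ → nothing }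

fromℚᵘ-homo-+ : ∀ p q → fromℚᵘ (p ℚᵘ.+ q) ≡ fromℚᵘ p + fromℚᵘ q
fromℚᵘ-homo-+ p q = toℚᵘ-injective (ℚᵘ.≃-trans (toℚᵘ-fromℚᵘ (p ℚᵘ.+ q)) (ℚᵘ.≃-sym
  (ℚᵘ.≃-trans (toℚᵘ-homo-+ (fromℚᵘ p) (fromℚᵘ q)) (ℚᵘ.+-cong (toℚᵘ-fromℚᵘ p) (toℚᵘ-fromℚᵘ q)))))

fromℚᵘ-homo-* : ∀ p q → fromℚᵘ (p ℚᵘ.* q) ≡ fromℚᵘ p * fromℚᵘ q
fromℚᵘ-homo-* p q = toℚᵘ-injective (ℚᵘ.≃-trans (toℚᵘ-fromℚᵘ (p ℚᵘ.* q)) (ℚᵘ.≃-sym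
  (ℚᵘ.≃-trans (toℚᵘ-homo-* (fromℚᵘ p) (fromℚᵘ q)) (ℚᵘ.*-cong (toℚᵘ-fromℚᵘ p) (toℚᵘ-fromℚᵘ q)))))

-- fromℕ a and inv (suc k) are definitionally fromℚᵘ (mkℚᵘ (+ a) 0) and fromℚᵘ (mkℚᵘ (+ 1) k),
-- so these identities reduce to cross-multiplied integer identities.
fromℕ-+ : ∀ a b → fromℕ (a ℕ.+ b) ≡ fromℕ a + fromℕ b
fromℕ-+ a b = trans (fromℚᵘ-cong {p} {q} (*≡* p≃q)) (fromℚᵘ-homo-+ (mkℚᵘ (+ a) 0) (mkℚᵘ (+ b) 0))
  where
  p = mkℚᵘ (+ (a ℕ.+ b)) 0
  q = mkℚᵘ (+ a) 0 ℚᵘ.+ mkℚᵘ (+ b) 0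
  p≃q : ℚᵘ.↥ p ℤ.* ℚᵘ.↧ q ≡ ℚᵘ.↥ q ℤ.* ℚᵘ.↧ p
  p≃q = cong (ℤ._* + 1) (trans (ℤ.pos-+ a b) (sym (cong₂ ℤ._+_ (ℤ.*-identityʳ (+ a)) (ℤ.*-identityʳ (+ b)))))

fromℕ-* : ∀ a b → fromℕ (a ℕ.* b) ≡ fromℕ a * fromℕ b
fromℕ-* a b = trans (fromℚᵘ-cong {p} {q} (*≡* p≃q)) (fromℚᵘ-homo-* (mkℚᵘ (+ a) 0) (mkℚᵘ (+ b) 0))
  where
  p = mkℚᵘ (+ (a ℕ.* b)) 0
  q = mkℚᵘ (+ a) 0 ℚᵘ.* mkℚᵘ (+ b) 0
  p≃q : ℚᵘ.↥ p ℤ.* ℚᵘ.↧ q ≡ ℚᵘ.↥ q ℤ.* ℚᵘ.↧ p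
  p≃q = cong (ℤ._* + 1) (ℤ.pos-* a b)

inv*fromℕ≡1 : ∀ k → inv (suc k) * fromℕ (suc k) ≡ 1ℚ
inv*fromℕ≡1 k =
  trans (sym (fromℚᵘ-homo-* (mkℚᵘ (+ 1) k) (mkℚᵘ (+ suc k) 0))) (fromℚᵘ-cong {p} {q} (*≡* p≃q))
  where
  p = mkℚᵘ (+ 1) k ℚᵘ.* mkℚᵘ (+ suc k) 0
  q = mkℚᵘ (+ 1) 0
  p≃q : ℚᵘ.↥ p ℤ.* ℚᵘ.↧ q ≡ ℚᵘ.↥ q ℤ.* ℚᵘ.↧ p
  p≃q = trans (ℤ.*-identityʳ (+ 1 ℤ.* + suc k)) (cong (λ m → + 1 ℤ.* + m) (sym (ℕ.*-identityʳ (suc k))))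

[k+1]*[n+1]C[k+1]≡[n+1]*nCk : ∀ n k → suc k ℕ.* (suc n C suc k) ≡ suc n ℕ.* (n C k)
[k+1]*[n+1]C[k+1]≡[n+1]*nCk zero    zero    = refl
[k+1]*[n+1]C[k+1]≡[n+1]*nCk zero    (suc k) =
  trans (cong (suc (suc k) ℕ.*_) (k>n⇒nCk≡0 (ℕ.s<s (ℕ.z<s {k})))) (ℕ.*-zeroʳ (suc (suc k)))
[k+1]*[n+1]C[k+1]≡[n+1]*nCk (suc n) zero    =
  trans (ℕ.*-identityˡ _) (trans (nC1≡n (suc (suc n))) (sym (ℕ.*-identityʳ _)))
[k+1]*[n+1]C[k+1]≡[n+1]*nCk (suc n) (suc k) = begin
  suc (suc k) ℕ.* (suc (suc n) C suc (suc k))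
    ≡⟨ cong (suc (suc k) ℕ.*_) (nCk+nC[k+1]≡[n+1]C[k+1] (suc n) (suc k)) ⟨
  suc (suc k) ℕ.* (a ℕ.+ b)
    ≡⟨ expand k a b ⟩
  a ℕ.+ suc k ℕ.* a ℕ.+ suc (suc k) ℕ.* b
    ≡⟨ cong₂ (λ x y → a ℕ.+ x ℕ.+ y)
         ([k+1]*[n+1]C[k+1]≡[n+1]*nCk n k) ([k+1]*[n+1]C[k+1]≡[n+1]*nCk n (suc k)) ⟩
  a ℕ.+ suc n ℕ.* (n C k) ℕ.+ suc n ℕ.* (n C suc k)
    ≡⟨ trans (ℕ.+-assoc a _ _) (cong (a ℕ.+_) (sym (ℕ.*-distribˡ-+ (suc n) (n C k) (n C suc k)))) ⟩
  a ℕ.+ suc n ℕ.* (n C k ℕ.+ n C suc k)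
    ≡⟨ cong (λ x → a ℕ.+ suc n ℕ.* x) (nCk+nC[k+1]≡[n+1]C[k+1] n k) ⟩
  a ℕ.+ suc n ℕ.* a
    ≡⟨⟩
  suc (suc n) ℕ.* a
    ∎
  where
  a = suc n C suc k
  b = suc n C suc (suc k)
  expand : ∀ k a b → suc (suc k) ℕ.* (a ℕ.+ b) ≡ a ℕ.+ suc k ℕ.* a ℕ.+ suc (suc k) ℕ.* b
  expand = ℕ-Solver.solve-∀

u*x≡v*y⇒x*v⁻¹≡u⁻¹*y : ∀ {u u⁻¹ v v⁻¹ x y : ℚ} → u⁻¹ * u ≡ 1ℚ → v⁻¹ * v ≡ 1ℚ →
                      u * x ≡ v * y → x * v⁻¹ ≡ u⁻¹ * y
u*x≡v*y⇒x*v⁻¹≡u⁻¹*y {u} {u⁻¹} {v} {v⁻¹} {x} {y} u⁻¹u≡1 v⁻¹v≡1 ux≡vy = begin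
  x * v⁻¹                ≡⟨ solve (x ∷ v⁻¹ ∷ []) ℚ-ring ⟩
  1ℚ * x * v⁻¹           ≡⟨ cong (λ c → c * x * v⁻¹) u⁻¹u≡1 ⟨
  u⁻¹ * u * x * v⁻¹      ≡⟨ solve (u⁻¹ ∷ u ∷ x ∷ v⁻¹ ∷ []) ℚ-ring ⟩
  u⁻¹ * (u * x) * v⁻¹    ≡⟨ cong (λ z → u⁻¹ * z * v⁻¹) ux≡vy ⟩
  u⁻¹ * (v * y) * v⁻¹    ≡⟨ solve (u⁻¹ ∷ v ∷ y ∷ v⁻¹ ∷ []) ℚ-ring ⟩
  u⁻¹ * y * (v⁻¹ * v)    ≡⟨ cong (u⁻¹ * y *_) v⁻¹v≡1 ⟩
  u⁻¹ * y * 1ℚ           ≡⟨ *-identityʳ (u⁻¹ * y) ⟩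
  u⁻¹ * y                ∎

binom : ℕ → ℕ → ℚ
binom n k = fromℕ (n C k)

binom-out-of-range : ∀ n → binom n (suc n) ≡ 0ℚ
binom-out-of-range n = cong fromℕ (k>n⇒nCk≡0 (ℕ.n<1+n n))

binom-pascal : ∀ n k → binom (suc n) (suc k) ≡ binom n k + binom n (suc k)
binom-pascal n k = trans (cong fromℕ (sym (nCk+nC[k+1]≡[n+1]C[k+1] n k))) (fromℕ-+ (n C k) (n C suc k))

binom-absorb : ∀ n k → binom n k * inv (suc k) ≡ inv (suc n) * binom (suc n) (suc k)
binom-absorb n k = u*x≡v*y⇒x*v⁻¹≡u⁻¹*y {fromℕ (suc n)} {inv (suc n)} {fromℕ (suc k)} {inv (suc k)}
  (inv*fromℕ≡1 n) (inv*fromℕ≡1 k) (begin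
    fromℕ (suc n) * binom n k              ≡⟨ fromℕ-* (suc n) (n C k) ⟨
    fromℕ (suc n ℕ.* (n C k))              ≡⟨ cong fromℕ ([k+1]*[n+1]C[k+1]≡[n+1]*nCk n k) ⟨
    fromℕ (suc k ℕ.* (suc n C suc k))      ≡⟨ fromℕ-* (suc k) (suc n C suc k) ⟩
    fromℕ (suc k) * binom (suc n) (suc k)  ∎)

sumTo-cong : ∀ n {f g : ℕ → ℚ} → (∀ k → f k ≡ g k) → sumTo n f ≡ sumTo n g
sumTo-cong zero    f≗g = refl
sumTo-cong (suc n) f≗g = cong₂ _+_ (sumTo-cong n f≗g) (f≗g (suc n))

sum₀ : ℕ → (ℕ → ℚ) → ℚ
sum₀ zero    f = f 0
sum₀ (suc n) f = sum₀ n f + f (suc n)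

sum₀-cong : ∀ n {f g : ℕ → ℚ} → (∀ k → f k ≡ g k) → sum₀ n f ≡ sum₀ n g
sum₀-cong zero    f≗g = f≗g 0
sum₀-cong (suc n) f≗g = cong₂ _+_ (sum₀-cong n f≗g) (f≗g (suc n))

sum₀-+ : ∀ n (f g : ℕ → ℚ) → sum₀ n (λ k → f k + g k) ≡ sum₀ n f + sum₀ n g
sum₀-+ zero    f g = refl
sum₀-+ (suc n) f g = trans (cong (_+ (f (suc n) + g (suc n))) (sum₀-+ n f g))
  (interchange (sum₀ n f) (sum₀ n g) (f (suc n)) (g (suc n)))
  where
  interchange : ∀ a b c d → a + b + (c + d) ≡ a + c + (b + d)
  interchange = solve-∀ ℚ-ring

sum₀-- : ∀ n (f g : ℕ → ℚ) → sum₀ n (λ k → f k - g k) ≡ sum₀ n f - sum₀ n g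
sum₀-- zero    f g = refl
sum₀-- (suc n) f g = trans (cong (_+ (f (suc n) - g (suc n))) (sum₀-- n f g))
  (interchange (sum₀ n f) (sum₀ n g) (f (suc n)) (g (suc n)))
  where
  interchange : ∀ a b c d → a - b + (c - d) ≡ a + c - (b + d)
  interchange = solve-∀ ℚ-ring

sum₀-*ˡ : ∀ n c (f : ℕ → ℚ) → sum₀ n (λ k → c * f k) ≡ c * sum₀ n f
sum₀-*ˡ zero    c f = refl
sum₀-*ˡ (suc n) c f =
  trans (cong (_+ c * f (suc n)) (sum₀-*ˡ n c f)) (sym (*-distribˡ-+ c (sum₀ n f) (f (suc n))))

sum₀-suc : ∀ n (f : ℕ → ℚ) → sum₀ (suc n) f ≡ f 0 + sum₀ n (λ k → f (suc k))
sum₀-suc zero    f = refl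
sum₀-suc (suc n) f = trans (cong (_+ f (suc (suc n))) (sum₀-suc n f)) (+-assoc (f 0) _ _)

sum₀≡+sumTo : ∀ n (f : ℕ → ℚ) → sum₀ n f ≡ f 0 + sumTo n f
sum₀≡+sumTo zero    f = sym (+-identityʳ (f 0))
sum₀≡+sumTo (suc n) f = trans (cong (_+ f (suc n)) (sum₀≡+sumTo n f)) (+-assoc (f 0) _ _)

binomialTerm : ℕ → (ℕ → ℚ) → ℕ → ℚ
binomialTerm n g j = binom n j * (sgn j * g j)

binomialTransform : ℕ → (ℕ → ℚ) → ℚ
binomialTransform n g = sum₀ n (binomialTerm n g)

binomialTerm-0 : ∀ n g → binomialTerm n g 0 ≡ g 0
binomialTerm-0 n g = trans (*-identityˡ (sgn 0 * g 0)) (*-identityˡ (g 0))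

binomialTerm-pascal : ∀ n g k →
  binomialTerm (suc n) g (suc k) ≡ binomialTerm n g (suc k) - binomialTerm n (λ j → g (suc j)) k
binomialTerm-pascal n g k = trans (cong (_* (sgn (suc k) * g (suc k))) (binom-pascal n k))
  (expand (binom n k) (binom n (suc k)) (sgn k) (g (suc k)))
  where
  expand : ∀ p q s x → (p + q) * (- s * x) ≡ q * (- s * x) - p * (s * x)
  expand = solve-∀ ℚ-ring

binomialTransform-cong : ∀ n {f g : ℕ → ℚ} → (∀ j → f j ≡ g j) →
  binomialTransform n f ≡ binomialTransform n g
binomialTransform-cong n f≗g = sum₀-cong n (λ j → cong (λ x → binom n j * (sgn j * x)) (f≗g j))

binomialTransform-+ : ∀ n (f g : ℕ → ℚ) →
  binomialTransform n (λ j → f j + g j) ≡ binomialTransform n f + binomialTransform n g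
binomialTransform-+ n f g = trans (sum₀-cong n (λ j → distrib (binom n j) (sgn j) (f j) (g j))) (sum₀-+ n _ _)
  where
  distrib : ∀ b s x y → b * (s * (x + y)) ≡ b * (s * x) + b * (s * y)
  distrib = solve-∀ ℚ-ring

binomialTransform-suc : ∀ n g →
  binomialTransform (suc n) g ≡ binomialTransform n g - binomialTransform n (λ j → g (suc j))
binomialTransform-suc n g = begin
  binomialTransform (suc n) g
    ≡⟨ sum₀-suc n (binomialTerm (suc n) g) ⟩
  t₀ + sum₀ n (λ k → binomialTerm (suc n) g (suc k))
    ≡⟨ cong (λ s → t₀ + s) (trans (sum₀-cong n (binomialTerm-pascal n g)) (sum₀-- n _ _)) ⟩
  t₀ + (sum₀ n (λ k → binomialTerm n g (suc k)) - T′)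
    ≡⟨ +-assoc-- t₀ _ T′ ⟨
  t₀ + sum₀ n (λ k → binomialTerm n g (suc k)) - T′
    ≡⟨ cong (_- T′) (sum₀-suc n (binomialTerm n g)) ⟨
  binomialTransform n g + binomialTerm n g (suc n) - T′
    ≡⟨ cong (λ t → binomialTransform n g + t - T′) top-vanishes ⟩
  binomialTransform n g + 0ℚ - T′
    ≡⟨ cong (_- T′) (+-identityʳ (binomialTransform n g)) ⟩
  binomialTransform n g - T′
    ∎
  where
  t₀ = binomialTerm n g 0
  T′ = binomialTransform n (λ j → g (suc j))
  top-vanishes : binomialTerm n g (suc n) ≡ 0ℚ
  top-vanishes =
    trans (cong (_* (sgn (suc n) * g (suc n))) (binom-out-of-range n)) (*-zeroˡ (sgn (suc n) * g (suc n)))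
  +-assoc-- : ∀ a b c → a + b - c ≡ a + (b - c)
  +-assoc-- = solve-∀ ℚ-ring

binomialTransform-absorb : ∀ n (f : ℕ → ℚ) →
  binomialTransform n (λ i → inv (suc i) * f (suc i)) ≡ - inv (suc n) * (binomialTransform (suc n) f - f 0)
binomialTransform-absorb n f = begin
  binomialTransform n (λ i → inv (suc i) * f (suc i))
    ≡⟨ sum₀-cong n absorbed ⟩
  sum₀ n (λ i → - inv (suc n) * t (suc i))
    ≡⟨ sum₀-*ˡ n (- inv (suc n)) (λ i → t (suc i)) ⟩
  - inv (suc n) * sum₀ n (λ i → t (suc i))
    ≡⟨ cong (λ s → - inv (suc n) * s) tail≡ ⟩
  - inv (suc n) * (binomialTransform (suc n) f - f 0)
    ∎
  where
  t = binomialTerm (suc n) f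
  absorbed : ∀ i → binomialTerm n (λ i → inv (suc i) * f (suc i)) i ≡ - inv (suc n) * t (suc i)
  absorbed i = begin
    binom n i * (sgn i * (inv (suc i) * f (suc i)))
      ≡⟨ regroup (binom n i) (sgn i) (inv (suc i)) (f (suc i)) ⟩
    binom n i * inv (suc i) * (sgn i * f (suc i))
      ≡⟨ cong (_* (sgn i * f (suc i))) (binom-absorb n i) ⟩
    inv (suc n) * binom (suc n) (suc i) * (sgn i * f (suc i))
      ≡⟨ flip-sign (inv (suc n)) (binom (suc n) (suc i)) (sgn i) (f (suc i)) ⟩
    - inv (suc n) * t (suc i)
      ∎
    where
    regroup : ∀ b s c x → b * (s * (c * x)) ≡ b * c * (s * x)
    regroup = solve-∀ ℚ-ring
    flip-sign : ∀ c b s x → c * b * (s * x) ≡ - c * (b * (- s * x))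
    flip-sign = solve-∀ ℚ-ring
  tail≡ : sum₀ n (λ i → t (suc i)) ≡ binomialTransform (suc n) f - f 0
  tail≡ = begin
    sum₀ n (λ i → t (suc i))                  ≡⟨ add-sub (t 0) (sum₀ n (λ i → t (suc i))) ⟩
    t 0 + sum₀ n (λ i → t (suc i)) - t 0      ≡⟨ cong₂ _-_ (sum₀-suc n t) (sym (binomialTerm-0 (suc n) f)) ⟨
    binomialTransform (suc n) f - f 0         ∎
    where
    add-sub : ∀ a s → s ≡ a + s - a
    add-sub = solve-∀ ℚ-ring

binomialTransform-1 : ∀ n → binomialTransform (suc n) (λ _ → 1ℚ) ≡ 0ℚ
binomialTransform-1 n =
  trans (binomialTransform-suc n (λ _ → 1ℚ)) (+-inverseʳ (binomialTransform n (λ _ → 1ℚ)))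

binomialTransform-inv : ∀ n → binomialTransform n (λ i → inv (suc i)) ≡ inv (suc n)
binomialTransform-inv n = begin
  binomialTransform n (λ i → inv (suc i))
    ≡⟨ binomialTransform-cong n (λ i → sym (*-identityʳ (inv (suc i)))) ⟩
  binomialTransform n (λ i → inv (suc i) * 1ℚ)
    ≡⟨ binomialTransform-absorb n (λ _ → 1ℚ) ⟩
  - inv (suc n) * (binomialTransform (suc n) (λ _ → 1ℚ) - 1ℚ)
    ≡⟨ cong (λ x → - inv (suc n) * (x - 1ℚ)) (binomialTransform-1 n) ⟩
  - inv (suc n) * (0ℚ - 1ℚ)
    ≡⟨ negate-twice (inv (suc n)) ⟩
  inv (suc n)
    ∎
  where
  negate-twice : ∀ x → - x * (0ℚ - 1ℚ) ≡ x
  negate-twice = solve-∀ ℚ-ring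

binomialTransform-H : ∀ n → binomialTransform n H ≡ - inv n
binomialTransform-H zero    = refl
binomialTransform-H (suc n) = begin
  binomialTransform (suc n) H
    ≡⟨ binomialTransform-suc n H ⟩
  binomialTransform n H - binomialTransform n (λ j → H j + inv (suc j))
    ≡⟨ cong (λ x → binomialTransform n H - x) (binomialTransform-+ n H (λ j → inv (suc j))) ⟩
  binomialTransform n H - (binomialTransform n H + binomialTransform n (λ j → inv (suc j)))
    ≡⟨ cong (λ x → binomialTransform n H - (binomialTransform n H + x)) (binomialTransform-inv n) ⟩
  binomialTransform n H - (binomialTransform n H + inv (suc n))
    ≡⟨ cancel (binomialTransform n H) (inv (suc n)) ⟩
  - inv (suc n)
    ∎
  where
  cancel : ∀ a x → a - (a + x) ≡ - x
  cancel = solve-∀ ℚ-ring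

binomialTransform-H∘pred : ∀ n → binomialTransform (suc n) (λ j → H (pred j)) ≡ H n
binomialTransform-H∘pred zero    = refl
binomialTransform-H∘pred (suc n) = begin
  binomialTransform (suc (suc n)) (λ j → H (pred j))
    ≡⟨ binomialTransform-suc (suc n) (λ j → H (pred j)) ⟩
  binomialTransform (suc n) (λ j → H (pred j)) - binomialTransform (suc n) H
    ≡⟨ cong₂ _-_ (binomialTransform-H∘pred n) (binomialTransform-H (suc n)) ⟩
  H n - - inv (suc n)
    ≡⟨ cancel (H n) (inv (suc n)) ⟩
  H (suc n)
    ∎
  where
  cancel : ∀ a x → a - - x ≡ a + x
  cancel = solve-∀ ℚ-ring

-- ½ (H_m² − H_m⁽²⁾) = Σ_{1 ≤ i < j ≤ m} 1/(ij).
harmonicPairSum : ℕ → ℚ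
harmonicPairSum m = (+ 1 / 2) * (H m * H m - H2 m)

harmonicPairSum-suc : ∀ m → harmonicPairSum (suc m) ≡ harmonicPairSum m + inv (suc m) * H m
harmonicPairSum-suc m = begin
  (+ 1 / 2) * ((H m + inv (suc m)) * (H m + inv (suc m)) - (H2 m + inv (suc m) * inv (suc m)))
    ≡⟨ expand (+ 1 / 2) (H m) (H2 m) (inv (suc m)) ⟩
  harmonicPairSum m + ((+ 1 / 2) + (+ 1 / 2)) * (inv (suc m) * H m)
    ≡⟨⟩
  harmonicPairSum m + 1ℚ * (inv (suc m) * H m)
    ≡⟨ cong (λ x → harmonicPairSum m + x) (*-identityˡ (inv (suc m) * H m)) ⟩
  harmonicPairSum m + inv (suc m) * H m
    ∎
  where
  expand : ∀ c h q i → c * ((h + i) * (h + i) - (q + i * i)) ≡ c * (h * h - q) + (c + c) * (i * h)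
  expand = solve-∀ ℚ-ring

binomialTransform-pairSum : ∀ m → binomialTransform m (λ j → inv j * H (pred j)) ≡ harmonicPairSum m
binomialTransform-pairSum zero    = refl
binomialTransform-pairSum (suc m) = begin
  binomialTransform (suc m) (λ j → inv j * H (pred j))
    ≡⟨ binomialTransform-suc m (λ j → inv j * H (pred j)) ⟩
  binomialTransform m (λ j → inv j * H (pred j)) - binomialTransform m (λ i → inv (suc i) * H i)
    ≡⟨ cong₂ _-_ (binomialTransform-pairSum m) (binomialTransform-absorb m (λ j → H (pred j))) ⟩
  harmonicPairSum m - - inv (suc m) * (binomialTransform (suc m) (λ j → H (pred j)) - 0ℚ)
    ≡⟨ cong (λ x → harmonicPairSum m - - inv (suc m) * (x - 0ℚ)) (binomialTransform-H∘pred m) ⟩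
  harmonicPairSum m - - inv (suc m) * (H m - 0ℚ)
    ≡⟨ simplify (harmonicPairSum m) (inv (suc m)) (H m) ⟩
  harmonicPairSum m + inv (suc m) * H m
    ≡⟨ harmonicPairSum-suc m ⟨
  harmonicPairSum (suc m)
    ∎
  where
  simplify : ∀ r i h → r - - i * (h - 0ℚ) ≡ r + i * h
  simplify = solve-∀ ℚ-ring

mainTheorem18 : (n : ℕ) → 1 ≤ n →
    sumTo n (λ k → fromℕ (suc n C suc k) * sgn (suc k) * inv (suc k) * H k)
      ≡ (+ 1 / 2) * (H (suc n) * H (suc n) - H2 (suc n))
mainTheorem18 n _ = begin
  sumTo n (λ k → fromℕ (suc n C suc k) * sgn (suc k) * inv (suc k) * H k)
    ≡⟨ sumTo-cong n (λ k → reassoc (binom (suc n) (suc k)) (sgn (suc k)) (inv (suc k)) (H k)) ⟩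
  sumTo n (λ k → t (suc k))
    ≡⟨ trans (+-identityˡ _) (+-identityˡ _) ⟨
  t 0 + (0ℚ + sumTo n (λ k → t (suc k)))
    ≡⟨ cong (λ x → t 0 + (x + sumTo n (λ k → t (suc k)))) (*-zeroʳ (binom (suc n) 1)) ⟨
  t 0 + (t 1 + sumTo n (λ k → t (suc k)))
    ≡⟨ trans (sum₀-suc n t) (cong (λ s → t 0 + s) (sum₀≡+sumTo n (λ k → t (suc k)))) ⟨
  binomialTransform (suc n) (λ j → inv j * H (pred j))
    ≡⟨ binomialTransform-pairSum (suc n) ⟩
  harmonicPairSum (suc n)
    ∎
  where
  -- t 0 and t 1 vanish because inv 0 = 0 and H 0 = 0; t 0 is even definitionally 0ℚ.
  t = binomialTerm (suc n) (λ j → inv j * H (pred j))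
  reassoc : ∀ b s i h → b * s * i * h ≡ b * (s * (i * h))
  reassoc = solve-∀ ℚ-ring
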